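{- Let $A, B, X$ be finite sets and let $f : A \nrightarrow X$, $g : B \nrightarrow X$ be arrows of $\mathbf{Rel}_f^{\mathcal{M}}$. Let $S$ be the (finite) set of minimal multi $(f,g)$-synchronisations, and define $p : S \nrightarrow A$, $q : S \nrightarrow B$ by $p(\mathcal{U},\mathcal{V}) = \mathcal{U}$ and $q(\mathcal{U},\mathcal{V}) = \mathcal{V}$. Then $f \circ p = g \circ q$, and this square is a weak pullback in $\mathbf{Rel}_f^{\mathcal{M}}$: for every finite set $Y$ and arrows $\alpha : Y \nrightarrow A$, $\beta : Y \nrightarrow B$ with $f \circ \alpha = g \circ \beta$, there exists $h : Y \nrightarrow S$ with $p \circ h = \alpha$ and $q \circ h = \beta$.
   Context: For a set $X$, $\mathcal{M}(X)$ is the set of finitely supported functions $X \to \mathbb{N}$ (multisets), with pointwise addition and pointwise order. For $h : A \to \mathcal{M}(X)$, $h^\#(\mathcal{U}) = \sum_{a \in A} \mathcal{U}(a)\, h(a)$. $\mathbf{Rel}_f^{\mathcal{M}}$ is the Kleisli category of the multiset monad restricted to finite sets: objects are finite sets, arrows $A \nrightarrow X$ are functions $A \to \mathcal{M}(X)$, the identity is $a \mapsto$ the singleton multiset $\{a\}$, and composition is $k \circ h = k^\# \circ h$. A multi $(f,g)$-synchronisation is a pair $(\mathcal{U}, \mathcal{V}) \in \mathcal{M}(A)\times\mathcal{M}(B)$ with $f^\#(\mathcal{U}) = g^\#(\mathcal{V})$, ordered pointwise; it is minimal if it is nonzero and every synchronisation below it is $(0,0)$ or equal to it. -}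

module Defs where

open import Data.Nat using (ℕ; zero; suc; _+_; _*_; _≤_)
open import Data.Fin using (Fin; zero; suc)
open import Data.Fin.Properties using (_≟_)
open import Data.Product using (Σ; _×_; _,_; proj₁; proj₂)
open import Data.Sum using (_⊎_)
open import Relation.Nullary using (¬_; yes; no)
open import Relation.Binary.PropositionalEquality using (_≡_)

-- Finite sets are represented by Fin n.
-- Multisets over Fin n: functions Fin n → ℕ (automatically finitely supported).
M : ℕ → Set
M n = Fin n → ℕ

-- Arrows A ⇸ X of Rel_f^M : functions A → M(X).
Arr : ℕ → ℕ → Set
Arr a x = Fin a → M x

sumFin : (n : ℕ) → (Fin n → ℕ) → ℕ
sumFin zero    f = 0
sumFin (suc n) f = f zero + sumFin n (λ i → f (suc i))

-- Kleisli extension: h^#(U) = Σ_a U(a) h(a).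
ext : {a x : ℕ} → Arr a x → M a → M x
ext {a} h U z = sumFin a (λ i → U i * h i z)

idArr : (a : ℕ) → Arr a a
idArr a i j with i ≟ j
... | yes _ = 1
... | no  _ = 0

_∘M_ : {a b c : ℕ} → Arr b c → Arr a b → Arr a c
(k ∘M h) i = ext k (h i)

_≐_ : {n : ℕ} → M n → M n → Set
U ≐ U' = ∀ i → U i ≡ U' i

_≈Arr_ : {a x : ℕ} → Arr a x → Arr a x → Set
h ≈Arr k = ∀ i → h i ≐ k i

_≤M_ : {n : ℕ} → M n → M n → Set
U ≤M U' = ∀ i → U i ≤ U' i

zeroM : {n : ℕ} → M n
zeroM _ = 0

IsSync : {a b x : ℕ} → Arr a x → Arr b x → M a × M b → Set
IsSync f g (U , V) = ext f U ≐ ext g V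

_≤P_ : {a b : ℕ} → M a × M b → M a × M b → Set
(U , V) ≤P (U' , V') = U ≤M U' × V ≤M V'

_≐P_ : {a b : ℕ} → M a × M b → M a × M b → Set
(U , V) ≐P (U' , V') = U ≐ U' × V ≐ V'

IsZeroP : {a b : ℕ} → M a × M b → Set
IsZeroP P = P ≐P (zeroM , zeroM)

IsMinimalSync : {a b x : ℕ} → Arr a x → Arr b x → M a × M b → Set
IsMinimalSync f g P =
  IsSync f g P × ¬ IsZeroP P ×
  (∀ Q → IsSync f g Q → Q ≤P P → IsZeroP Q ⊎ Q ≐P P)

-- An enumeration e : Fin s → M(A) × M(B) exhibiting Fin s as the set S of
-- minimal synchronisations: every e i is minimal, e is injective, and every
-- minimal synchronisation is (equal to) some e i.
IsEnumMinSync : {a b x : ℕ} → Arr a x → Arr b x → (s : ℕ) → (Fin s → M a × M b) → Set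
IsEnumMinSync f g s e =
  (∀ i → IsMinimalSync f g (e i)) ×
  (∀ i j → e i ≐P e j → i ≡ j) ×
  (∀ P → IsMinimalSync f g P → Σ (Fin s) (λ i → e i ≐P P))

projP : {a b s : ℕ} → (Fin s → M a × M b) → Arr s a
projP e i = proj₁ (e i)

projQ : {a b s : ℕ} → (Fin s → M a × M b) → Arr s b
projQ e i = proj₂ (e i)

IsWeakPullbackSquare : {a b x s : ℕ} → Arr a x → Arr b x → Arr s a → Arr s b → Set
IsWeakPullbackSquare {a} {b} {x} {s} f g p q =
  (f ∘M p) ≈Arr (g ∘M q) ×
  (∀ (y : ℕ) (α : Arr y a) (β : Arr y b) → (f ∘M α) ≈Arr (g ∘M β) →
     Σ (Arr y s) (λ h → ((p ∘M h) ≈Arr α) × ((q ∘M h) ≈Arr β)))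

module Submission where

-- Searching the finitely many pairs below a non-zero
-- synchronisation finds a minimal one under it (minimalBelow), and removing it
-- leaves a smaller synchronisation.  So every synchronisation is a combination
-- comb e c = (p^#(c), q^#(c)) of the enumerated minimal ones (decompose), which
-- gives the mediating arrow; the square commutes as each e i synchronises.
--
-- Once their entries are bounded, the minimal synchronisations are
-- enumerated by filtering a finite box (enumerate).  The bound is proved by
-- induction on the target (boundedMinimal): for X = 1 + X' write a minimal P as
-- comb e c over the minimal synchronisations of the restrictions to X'; then c
-- balances the weights at the new point, and an exchange lemma
-- (balancedSubmultiset) shows that if |c| > 2K+1 a proper balanced part of c
-- would contradict the minimality of P.

open import Defs
open import Algebra.Properties.Semiring.Sum as SemiringSum using ()
open import Data.Nat using (ℕ; zero; suc; _+_; _*_; _∸_; _≤_; _<_; _≤′_; ≤′-refl; ≤′-step; z≤n; s≤s; _≤?_; >-nonZero)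
open import Data.Nat.Properties hiding (_≟_)
open import Data.Nat.Induction using (<-wellFounded)
open import Data.Nat.Tactic.RingSolver using (solve-∀)
open import Data.Fin using (Fin; zero; suc; toℕ; fromℕ<)
open import Data.Fin.Properties using (_≟_; any?; pigeonhole; toℕ<n; toℕ-fromℕ<)
open import Data.Vec.Functional using (tail) renaming ([] to []ᵥ; _∷_ to _∷ᵥ_)
open import Data.Vec.Functional.Relation.Binary.Pointwise.Properties as Pointwise using ()
open import Data.Product using (Σ; ∃; _×_; _,_; proj₁; proj₂)
open import Data.Product.Relation.Binary.Pointwise.NonDependent using (×-decSetoid)
open import Data.Sum as Sum using (_⊎_; inj₁; inj₂)
open import Data.Empty using (⊥; ⊥-elim)
open import Data.List using (List; [_]; upTo; cartesianProductWith; cartesianProduct; filter; deduplicate; length; lookup)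
open import Data.List.Relation.Unary.Any as Any using (Any; here)
open import Data.List.Relation.Unary.All as All using (All)
import Data.List.Relation.Unary.Any.Properties as Anyₚ
import Data.List.Relation.Unary.All.Properties as Allₚ
open import Data.List.Relation.Unary.AllPairs using (AllPairs; _∷_)
open import Data.List.Relation.Unary.Unique.DecSetoid.Properties using (deduplicate-!)
open import Data.List.Membership.Propositional.Properties using (∈-upTo⁺; ∈-lookup)
import Data.List.Membership.Setoid.Properties as SetoidMembership
open import Function using (_∘_)
open import Induction.WellFounded using (Acc; acc; WellFounded)
open import Relation.Binary using (DecSetoid)
open import Relation.Binary.Construct.On as On using ()
open import Relation.Nullary using (¬_; yes; no; Dec)
open import Relation.Nullary.Decidable using (_×-dec_; ¬?)
open import Relation.Binary.PropositionalEquality using (_≡_; refl; sym; trans; cong; cong₂; subst; subst₂; module ≡-Reasoning)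

open ≡-Reasoning
open SemiringSum +-*-semiring using (sum; sum-cong-≗; ∑-distrib-+; ∑-comm; *-distribˡ-sum; *-distribʳ-sum; sum-replicate-zero)

sumFin≡sum : ∀ n (f : Fin n → ℕ) → sumFin n f ≡ sum f
sumFin≡sum zero    f = refl
sumFin≡sum (suc n) f = cong (f zero +_) (sumFin≡sum n (tail f))

sumFin-cong : ∀ n {f g : Fin n → ℕ} → (∀ i → f i ≡ g i) → sumFin n f ≡ sumFin n g
sumFin-cong n {f} {g} f≗g = begin
  sumFin n f ≡⟨ sumFin≡sum n f ⟩
  sum f      ≡⟨ sum-cong-≗ f≗g ⟩
  sum g      ≡⟨ sumFin≡sum n g ⟨
  sumFin n g ∎

sumFin-zeros : ∀ n → sumFin n (λ _ → 0) ≡ 0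
sumFin-zeros n = trans (sumFin≡sum n _) (sum-replicate-zero n)

sumFin-+ : ∀ n (f g : Fin n → ℕ) → sumFin n (λ i → f i + g i) ≡ sumFin n f + sumFin n g
sumFin-+ n f g = begin
  sumFin n (λ i → f i + g i) ≡⟨ sumFin≡sum n _ ⟩
  sum (λ i → f i + g i)      ≡⟨ ∑-distrib-+ f g ⟩
  sum f + sum g              ≡⟨ cong₂ _+_ (sumFin≡sum n f) (sumFin≡sum n g) ⟨
  sumFin n f + sumFin n g    ∎

sumFin-*ˡ : ∀ n k (f : Fin n → ℕ) → sumFin n (λ i → k * f i) ≡ k * sumFin n f
sumFin-*ˡ n k f = begin
  sumFin n (λ i → k * f i) ≡⟨ sumFin≡sum n _ ⟩
  sum (λ i → k * f i)      ≡⟨ *-distribˡ-sum k f ⟨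
  k * sum f                ≡⟨ cong (k *_) (sumFin≡sum n f) ⟨
  k * sumFin n f           ∎

sumFin-*ʳ : ∀ n k (f : Fin n → ℕ) → sumFin n (λ i → f i * k) ≡ sumFin n f * k
sumFin-*ʳ n k f = begin
  sumFin n (λ i → f i * k) ≡⟨ sumFin≡sum n _ ⟩
  sum (λ i → f i * k)      ≡⟨ *-distribʳ-sum k f ⟨
  sum f * k                ≡⟨ cong (_* k) (sumFin≡sum n f) ⟨
  sumFin n f * k           ∎

sumFin-swap : ∀ m n (F : Fin m → Fin n → ℕ) →
  sumFin m (λ i → sumFin n (F i)) ≡ sumFin n (λ j → sumFin m (λ i → F i j))
sumFin-swap m n F = begin
  sumFin m (λ i → sumFin n (F i))         ≡⟨ sumFin-cong m (λ i → sumFin≡sum n (F i)) ⟩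
  sumFin m (λ i → sum (F i))              ≡⟨ sumFin≡sum m _ ⟩
  sum (λ i → sum (F i))                   ≡⟨ ∑-comm F ⟩
  sum (λ j → sum (λ i → F i j))           ≡⟨ sumFin≡sum n _ ⟨
  sumFin n (λ j → sum (λ i → F i j))      ≡⟨ sumFin-cong n (λ j → sumFin≡sum m _) ⟨
  sumFin n (λ j → sumFin m (λ i → F i j)) ∎

sumFin-mono : ∀ n {f g : Fin n → ℕ} → (∀ i → f i ≤ g i) → sumFin n f ≤ sumFin n g
sumFin-mono zero    f≤g = z≤n
sumFin-mono (suc n) f≤g = +-mono-≤ (f≤g zero) (sumFin-mono n (f≤g ∘ suc))

sumFin-mono-< : ∀ n {f g : Fin n → ℕ} → (∀ i → f i ≤ g i) → ∀ i → f i < g i → sumFin n f < sumFin n g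
sumFin-mono-< (suc n) f≤g zero    fi<gi = +-mono-<-≤ fi<gi (sumFin-mono n (f≤g ∘ suc))
sumFin-mono-< (suc n) f≤g (suc i) fi<gi = +-mono-≤-< (f≤g zero) (sumFin-mono-< n (f≤g ∘ suc) i fi<gi)

sumFin-mono-≡ : ∀ n {f g : Fin n → ℕ} → (∀ i → f i ≤ g i) → sumFin n f ≡ sumFin n g → ∀ i → f i ≡ g i
sumFin-mono-≡ (suc n) {f} {g} f≤g eq = pointwise
  where
  head≡ : f zero ≡ g zero
  head≡ = ≤-antisym (f≤g zero)
    (+-cancelʳ-≤ _ _ _ (≤-trans (≤-reflexive (sym eq)) (+-monoʳ-≤ (f zero) (sumFin-mono n (f≤g ∘ suc)))))
  pointwise : ∀ i → f i ≡ g i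
  pointwise zero    = head≡
  pointwise (suc i) = sumFin-mono-≡ n (f≤g ∘ suc) (+-cancelˡ-≡ (f zero) _ _ (trans eq (cong (_+ _) (sym head≡)))) i

term≤sumFin : ∀ n (f : Fin n → ℕ) i → f i ≤ sumFin n f
term≤sumFin (suc n) f zero    = m≤m+n (f zero) _
term≤sumFin (suc n) f (suc i) = ≤-trans (term≤sumFin n (tail f) i) (m≤n+m _ (f zero))

-- Multisets: pointwise sum and truncated difference, total size, and the
-- weighted size dot U W = Σ_i U(i) W(i).  Note ext h U z = dot U (λ i → h i z).
_+M_ : ∀ {n} → M n → M n → M n
(U +M V) i = U i + V i

_∸M_ : ∀ {n} → M n → M n → M n
(U ∸M V) i = U i ∸ V i

tot : ∀ {n} → M n → ℕ
tot {n} U = sumFin n U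

dot : ∀ {n} → M n → (Fin n → ℕ) → ℕ
dot {n} U W = sumFin n (λ i → U i * W i)

tot-∸ : ∀ {n} {U V : M n} → V ≤M U → tot (U ∸M V) + tot V ≡ tot U
tot-∸ {n} {U} {V} V≤U = trans (sym (sumFin-+ n (U ∸M V) V)) (sumFin-cong n (λ i → m∸n+n≡m (V≤U i)))

dot-+ : ∀ {n} (U V : M n) (W : Fin n → ℕ) → dot (U +M V) W ≡ dot U W + dot V W
dot-+ {n} U V W = trans (sumFin-cong n (λ i → *-distribʳ-+ (W i) (U i) (V i))) (sumFin-+ n _ _)

dot-∸ : ∀ {n} {U V : M n} (W : Fin n → ℕ) → V ≤M U → dot (U ∸M V) W + dot V W ≡ dot U W
dot-∸ {n} {U} {V} W V≤U = begin
  dot (U ∸M V) W + dot V W ≡⟨ dot-+ (U ∸M V) V W ⟨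
  dot ((U ∸M V) +M V) W    ≡⟨ sumFin-cong n (λ i → cong (_* W i) (m∸n+n≡m (V≤U i))) ⟩
  dot U W                  ∎

dot-mono : ∀ {n} {U V : M n} (W : Fin n → ℕ) → U ≤M V → dot U W ≤ dot V W
dot-mono {n} W U≤V = sumFin-mono n (λ i → *-monoˡ-≤ (W i) (U≤V i))

∸M-nonempty : ∀ {n} {U V : M n} → V ≤M U → tot V < tot U → 1 ≤ tot (U ∸M V)
∸M-nonempty {U = U} {V} V≤U V<U = +-cancelʳ-≤ (tot V) 1 (tot (U ∸M V)) (subst (suc (tot V) ≤_) (sym (tot-∸ V≤U)) V<U)

positiveEntry : ∀ {n} (U : M n) → 1 ≤ tot U → ∃ λ i → 1 ≤ U i
positiveEntry {n} U 1≤totU with any? (λ i → 1 ≤? U i)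
... | yes found = found
... | no  none  = ⊥-elim (<⇒≱ 1≤totU (≤-reflexive allZero))
  where
  allZero : tot U ≡ 0
  allZero = trans (sumFin-cong n (λ i → n<1⇒n≡0 (≰⇒> (λ 1≤Ui → none (i , 1≤Ui))))) (sumFin-zeros n)

pick : ∀ {n} (W₁ W₂ : Fin n → ℕ) (r : M n) → 1 ≤ tot r → dot r W₂ ≤ dot r W₁ →
  ∃ λ h → 1 ≤ r h × W₂ h ≤ W₁ h
pick {n} W₁ W₂ r 1≤totr r₂≤r₁ with any? (λ h → (1 ≤? r h) ×-dec (W₂ h ≤? W₁ h))
... | yes found = found
... | no  none  = ⊥-elim (<⇒≱ r₁<r₂ r₂≤r₁)
  where
  h₀ : Fin n
  h₀ = proj₁ (positiveEntry r 1≤totr)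
  1≤rh₀ : 1 ≤ r h₀
  1≤rh₀ = proj₂ (positiveEntry r 1≤totr)
  W₁<W₂ : ∀ {h} → 1 ≤ r h → W₁ h < W₂ h
  W₁<W₂ {h} 1≤rh = ≰⇒> (λ W₂≤W₁ → none (h , 1≤rh , W₂≤W₁))
  r₁≤r₂ : ∀ h → r h * W₁ h ≤ r h * W₂ h
  r₁≤r₂ h with r h in eq
  ... | zero  = z≤n
  ... | suc k = *-monoʳ-≤ (suc k) (<⇒≤ (W₁<W₂ (subst (1 ≤_) (sym eq) (s≤s z≤n))))
  r₁<r₂ : dot r W₁ < dot r W₂
  r₁<r₂ = sumFin-mono-< n r₁≤r₂ h₀ (*-monoʳ-< (r h₀) {{>-nonZero 1≤rh₀}} (W₁<W₂ 1≤rh₀))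

idArr-diag : ∀ n (i : Fin n) → idArr n i i ≡ 1
idArr-diag n i with i ≟ i
... | yes _   = refl
... | no i≢i = ⊥-elim (i≢i refl)

idArr-suc : ∀ n (i j : Fin n) → idArr (suc n) (suc i) (suc j) ≡ idArr n i j
idArr-suc n i j with i ≟ j
... | yes _ = refl
... | no  _ = refl

idArr≤ : ∀ {n} {U : M n} {i} → 1 ≤ U i → idArr n i ≤M U
idArr≤ {n} {U} {i} 1≤Ui j with i ≟ j
... | yes refl = 1≤Ui
... | no  _    = z≤n

addUnit≤ : ∀ {n} {U V : M n} {h} → V ≤M U → 1 ≤ U h ∸ V h → (V +M idArr n h) ≤M U
addUnit≤ {n} {U} {V} {h} V≤U 1≤ j = ≤-trans (+-monoʳ-≤ (V j) (idArr≤ {U = U ∸M V} 1≤ j)) (≤-reflexive (m+[n∸m]≡n (V≤U j)))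

dot-idArr : ∀ n (i : Fin n) (W : Fin n → ℕ) → dot (idArr n i) W ≡ W i
dot-idArr (suc n) zero    W = trans (cong₂ _+_ (+-identityʳ (W zero)) (sumFin-zeros n)) (+-identityʳ (W zero))
dot-idArr (suc n) (suc i) W =
  trans (sumFin-cong n (λ j → cong (_* W (suc j)) (idArr-suc n i j))) (dot-idArr n i (tail W))

tot-idArr : ∀ n (i : Fin n) → tot (idArr n i) ≡ 1
tot-idArr n i = trans (sumFin-cong n (λ j → sym (*-identityʳ (idArr n i j)))) (dot-idArr n i (λ _ → 1))

ext-cong : ∀ {a x} (h : Arr a x) {U V : M a} → U ≐ V → ext h U ≐ ext h V
ext-cong {a} h U≐V z = sumFin-cong a (λ i → cong (_* h i z) (U≐V i))

ext-∸ : ∀ {a x} (h : Arr a x) {U V : M a} → V ≤M U → ∀ z → ext h (U ∸M V) z + ext h V z ≡ ext h U z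
ext-∸ h V≤U z = dot-∸ (λ i → h i z) V≤U

ext-mono : ∀ {a x} (h : Arr a x) {U V : M a} → U ≤M V → ext h U ≤M ext h V
ext-mono h U≤V z = dot-mono (λ i → h i z) U≤V

ext-zero : ∀ {a x} (h : Arr a x) → ext h zeroM ≐ zeroM
ext-zero {a} h z = sumFin-zeros a

ext-idArr : ∀ {a x} (h : Arr a x) (i : Fin a) → ext h (idArr a i) ≐ h i
ext-idArr {a} h i z = dot-idArr a i (λ j → h j z)

ext-ext : ∀ {s a x} (f : Arr a x) (p : Arr s a) (c : M s) → ext f (ext p c) ≐ ext (f ∘M p) c
ext-ext {s} {a} f p c z = begin
  sumFin a (λ i → sumFin s (λ h → c h * p h i) * f i z)   ≡⟨ sumFin-cong a (λ i → sumFin-*ʳ s (f i z) _) ⟨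
  sumFin a (λ i → sumFin s (λ h → c h * p h i * f i z))   ≡⟨ sumFin-swap a s _ ⟩
  sumFin s (λ h → sumFin a (λ i → c h * p h i * f i z))
    ≡⟨ sumFin-cong s (λ h → sumFin-cong a (λ i → *-assoc (c h) (p h i) (f i z))) ⟩
  sumFin s (λ h → sumFin a (λ i → c h * (p h i * f i z))) ≡⟨ sumFin-cong s (λ h → sumFin-*ˡ a (c h) _) ⟩
  sumFin s (λ h → c h * ext f (p h) z)                    ∎

ext-bounded : ∀ {s x} (h : Arr s x) (N : ℕ) → (∀ k z → h k z ≤ N) → ∀ c z → ext h c z ≤ tot c * N
ext-bounded {s} h N h≤N c z = ≤-trans (sumFin-mono s (λ k → *-monoʳ-≤ (c k) (h≤N k z))) (≤-reflexive (sumFin-*ʳ s N c))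

box : ∀ n → M n → List (M n)
box zero    B = [ []ᵥ ]
box (suc n) B = cartesianProductWith _∷ᵥ_ (upTo (suc (B zero))) (box n (tail B))

box-complete : ∀ n (B W : M n) → W ≤M B → Any (W ≐_) (box n B)
box-complete zero    B W W≤B = here (λ ())
box-complete (suc n) B W W≤B = Anyₚ.cartesianProductWith⁺ _∷ᵥ_ consEq
  (∈-upTo⁺ (s≤s (W≤B zero))) (box-complete n (tail B) (tail W) (W≤B ∘ suc))
  where
  consEq : ∀ {k V} → W zero ≡ k → tail W ≐ V → W ≐ (k ∷ᵥ V)
  consEq k≡ V≐ zero    = k≡
  consEq k≡ V≐ (suc i) = V≐ i

multisetDecSetoid : ℕ → DecSetoid _ _
multisetDecSetoid n = Pointwise.decSetoid ≡-decSetoid n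

_≟M_ : ∀ {n} (U V : M n) → Dec (U ≐ V)
_≟M_ {n} = DecSetoid._≟_ (multisetDecSetoid n)

_≤M?_ : ∀ {n} (U V : M n) → Dec (U ≤M V)
_≤M?_ = Pointwise.decidable _≤?_

Pair : ℕ → ℕ → Set
Pair a b = M a × M b

pairDecSetoid : ℕ → ℕ → DecSetoid _ _
pairDecSetoid a b = ×-decSetoid (multisetDecSetoid a) (multisetDecSetoid b)

module _ {a b : ℕ} where
  open DecSetoid (pairDecSetoid a b) public
    using () renaming (_≟_ to _≟P_; sym to ≐P-sym; trans to ≐P-trans; setoid to pairSetoid)

_≤P?_ : ∀ {a b} (P Q : Pair a b) → Dec (P ≤P Q)
(U , V) ≤P? (U′ , V′) = (U ≤M? U′) ×-dec (V ≤M? V′)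

≤P-refl : ∀ {a b} {P : Pair a b} → P ≤P P
≤P-refl = (λ _ → ≤-refl) , (λ _ → ≤-refl)

≤P-trans : ∀ {a b} {P Q R : Pair a b} → P ≤P Q → Q ≤P R → P ≤P R
≤P-trans (U≤ , V≤) (U≤′ , V≤′) = (λ i → ≤-trans (U≤ i) (U≤′ i)) , (λ j → ≤-trans (V≤ j) (V≤′ j))

≐P⇒≤P : ∀ {a b} {P Q : Pair a b} → P ≐P Q → P ≤P Q
≐P⇒≤P (U≐ , V≐) = (≤-reflexive ∘ U≐) , (≤-reflexive ∘ V≐)

≤P-zero : ∀ {a b} {P Q : Pair a b} → P ≤P Q → IsZeroP Q → IsZeroP P
≤P-zero (U≤ , V≤) (U≐0 , V≐0) = (λ i → n≤0⇒n≡0 (≤-trans (U≤ i) (≤-reflexive (U≐0 i)))) ,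
                                (λ j → n≤0⇒n≡0 (≤-trans (V≤ j) (≤-reflexive (V≐0 j))))

_∸P_ : ∀ {a b} → Pair a b → Pair a b → Pair a b
(U , V) ∸P (U′ , V′) = U ∸M U′ , V ∸M V′

∸P≤P : ∀ {a b} (P Q : Pair a b) → (P ∸P Q) ≤P P
∸P≤P (U , V) (U′ , V′) = (λ i → m∸n≤m (U i) (U′ i)) , (λ j → m∸n≤m (V j) (V′ j))

∸P-unchanged : ∀ {a b} {P Q : Pair a b} → Q ≤P P → (P ∸P Q) ≐P P → IsZeroP Q
∸P-unchanged (U′≤U , V′≤V) (U≐ , V≐) = (λ i → unchanged (U′≤U i) (U≐ i)) , (λ j → unchanged (V′≤V j) (V≐ j))
  where
  unchanged : ∀ {m n} → n ≤ m → m ∸ n ≡ m → n ≡ 0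
  unchanged {m} {n} n≤m m∸n≡m = +-cancelˡ-≡ m n 0 (begin
    m + n       ≡⟨ cong (_+ n) m∸n≡m ⟨
    m ∸ n + n   ≡⟨ m∸n+n≡m n≤m ⟩
    m           ≡⟨ +-identityʳ m ⟨
    m + 0       ∎)

uniform : ∀ {a b} → ℕ → Pair a b
uniform N = (λ _ → N) , (λ _ → N)

isZero? : ∀ {a b} (P : Pair a b) → Dec (IsZeroP P)
isZero? P = P ≟P (zeroM , zeroM)

below : ∀ {a b} → Pair a b → List (Pair a b)
below {a} {b} (U , V) = cartesianProduct (box a U) (box b V)

below-complete : ∀ {a b} {P Q : Pair a b} → Q ≤P P → Any (Q ≐P_) (below P)
below-complete {a} {b} {U , V} {U′ , V′} (U′≤U , V′≤V) =
  Anyₚ.cartesianProduct⁺ (box-complete a U U′ U′≤U) (box-complete b V V′ V′≤V)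

size : ∀ {a b} → Pair a b → ℕ
size (U , V) = tot U + tot V

_⊏_ : ∀ {a b} → Pair a b → Pair a b → Set
P ⊏ Q = size P < size Q

⊏-wellFounded : ∀ {a b} → WellFounded (_⊏_ {a} {b})
⊏-wellFounded = On.wellFounded size <-wellFounded

tot-strict : ∀ {n} {U V : M n} → U ≤M V → ¬ U ≐ V → tot U < tot V
tot-strict {n} U≤V U≉V with m≤n⇒m<n∨m≡n (sumFin-mono n U≤V)
... | inj₁ lt = lt
... | inj₂ eq = ⊥-elim (U≉V (sumFin-mono-≡ n U≤V eq))

⊏-strict : ∀ {a b} {P Q : Pair a b} → Q ≤P P → ¬ Q ≐P P → Q ⊏ P
⊏-strict {a} {b} {U , V} {U′ , V′} (U′≤U , V′≤V) Q≉P with U′ ≟M U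
... | yes U′≐U = +-mono-≤-< (≤-reflexive (sumFin-cong a U′≐U)) (tot-strict V′≤V (λ V′≐V → Q≉P (U′≐U , V′≐V)))
... | no  U′≉U = +-mono-<-≤ (tot-strict U′≤U U′≉U) (sumFin-mono b V′≤V)

remainder⊏ : ∀ {a b} {P Q : Pair a b} → Q ≤P P → ¬ IsZeroP Q → (P ∸P Q) ⊏ P
remainder⊏ {P = P} {Q} Q≤P Q≠0 = ⊏-strict (∸P≤P P Q) (Q≠0 ∘ ∸P-unchanged Q≤P)

lookup-injective : ∀ {a b} {L : List (Pair a b)} → AllPairs (λ P Q → ¬ P ≐P Q) L →
  ∀ i j → lookup L i ≐P lookup L j → i ≡ j
lookup-injective (_  ∷ _)        zero    zero    _  = refl
lookup-injective (P≉ ∷ _)        zero    (suc j) eq = ⊥-elim (All.lookup P≉ (∈-lookup j) eq)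
lookup-injective (P≉ ∷ _)        (suc i) zero    eq = ⊥-elim (All.lookup P≉ (∈-lookup i) (≐P-sym eq))
lookup-injective (_  ∷ distinct) (suc i) (suc j) eq = cong suc (lookup-injective distinct i j eq)

comb : ∀ {s a b} → (Fin s → Pair a b) → M s → Pair a b
comb e c = ext (projP e) c , ext (projQ e) c

comb-zero : ∀ {s a b} (e : Fin s → Pair a b) → comb e zeroM ≐P (zeroM , zeroM)
comb-zero e = ext-zero (projP e) , ext-zero (projQ e)

comb-mono : ∀ {s a b} (e : Fin s → Pair a b) {c d : M s} → d ≤M c → comb e d ≤P comb e c
comb-mono e d≤c = ext-mono (projP e) d≤c , ext-mono (projQ e) d≤c

comb-member : ∀ {s a b} (e : Fin s → Pair a b) {c : M s} {h} → 1 ≤ c h → e h ≤P comb e c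
comb-member e {c} {h} 1≤ch = ≤P-trans (≐P⇒≤P (≐P-sym (ext-idArr (projP e) h , ext-idArr (projQ e) h)))
                                       (comb-mono e (idArr≤ {U = c} 1≤ch))

comb-addUnit : ∀ {s a b} (e : Fin s → Pair a b) (c : M s) h {P Q : Pair a b} →
  Q ≤P P → e h ≐P Q → comb e c ≐P (P ∸P Q) → comb e (c +M idArr s h) ≐P P
comb-addUnit e c h (U′≤U , V′≤V) (pₕ≐ , qₕ≐) (pc≐ , qc≐) =
  addUnit (projP e) U′≤U pₕ≐ pc≐ , addUnit (projQ e) V′≤V qₕ≐ qc≐
  where
  addUnit : ∀ {n} (k : Arr _ n) {W W′ : M n} → W′ ≤M W → k h ≐ W′ → ext k c ≐ (W ∸M W′) → ext k (c +M idArr _ h) ≐ W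
  addUnit k {W} {W′} W′≤W kₕ≐ kc≐ z = begin
    ext k (c +M idArr _ h) z        ≡⟨ dot-+ c (idArr _ h) (λ j → k j z) ⟩
    ext k c z + ext k (idArr _ h) z ≡⟨ cong₂ _+_ (kc≐ z) (trans (ext-idArr k h z) (kₕ≐ z)) ⟩
    W z ∸ W′ z + W′ z               ≡⟨ m∸n+n≡m (W′≤W z) ⟩
    W z                             ∎

comb-cancel : ∀ {s a b} (e : Fin s → Pair a b) {c d : M s} → d ≤M c → comb e d ≐P comb e c →
  IsZeroP (comb e (c ∸M d))
comb-cancel e {c} {d} d≤c (pd≐ , qd≐) = rest (projP e) pd≐ , rest (projQ e) qd≐
  where
  rest : ∀ {n} (k : Arr _ n) → ext k d ≐ ext k c → ext k (c ∸M d) ≐ zeroM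
  rest k kd≐kc z = +-cancelʳ-≡ (ext k d z) _ 0 (trans (ext-∸ k d≤c z) (sym (kd≐kc z)))

module Synchronisations {a b x : ℕ} (f : Arr a x) (g : Arr b x) where

  sync? : ∀ P → Dec (IsSync f g P)
  sync? (U , V) = ext f U ≟M ext g V

  sync-resp : ∀ {P Q} → P ≐P Q → IsSync f g P → IsSync f g Q
  sync-resp (U≐ , V≐) sP z = trans (sym (ext-cong f U≐ z)) (trans (sP z) (ext-cong g V≐ z))

  sync-∸ : ∀ {P Q} → Q ≤P P → IsSync f g Q → IsSync f g P → IsSync f g (P ∸P Q)
  sync-∸ {U , V} {U′ , V′} (U′≤U , V′≤V) sQ sP z = +-cancelʳ-≡ (ext f U′ z) _ _ (begin
    ext f (U ∸M U′) z + ext f U′ z ≡⟨ ext-∸ f U′≤U z ⟩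
    ext f U z                      ≡⟨ sP z ⟩
    ext g V z                      ≡⟨ ext-∸ g V′≤V z ⟨
    ext g (V ∸M V′) z + ext g V′ z ≡⟨ cong (ext g (V ∸M V′) z +_) (sQ z) ⟨
    ext g (V ∸M V′) z + ext f U′ z ∎)

  NoProperSubSync : Pair a b → Set
  NoProperSubSync P = ∀ Q → IsSync f g Q → Q ≤P P → IsZeroP Q ⊎ Q ≐P P

  ProperSubSync : Pair a b → Pair a b → Set
  ProperSubSync P Q = IsSync f g Q × ¬ IsZeroP Q × ¬ Q ≐P P × Q ≤P P

  properSubSync? : ∀ P Q → Dec (ProperSubSync P Q)
  properSubSync? P Q = sync? Q ×-dec ¬? (isZero? Q) ×-dec ¬? (Q ≟P P) ×-dec (Q ≤P? P)

  proper-resp : ∀ {P Q Q′} → Q ≐P Q′ → ProperSubSync P Q → ProperSubSync P Q′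
  proper-resp Q≐Q′ (sQ , Q≠0 , Q≉P , Q≤P) =
    sync-resp Q≐Q′ sQ , (λ Q′≐0 → Q≠0 (≐P-trans Q≐Q′ Q′≐0)) , (λ Q′≐P → Q≉P (≐P-trans Q≐Q′ Q′≐P)) ,
    ≤P-trans (≐P⇒≤P (≐P-sym Q≐Q′)) Q≤P

  findProperSubSync : ∀ P → ∃ (ProperSubSync P) ⊎ NoProperSubSync P
  findProperSubSync P with Any.any? (properSubSync? P) (below P)
  ... | yes found = inj₁ (Any.lookup found , Anyₚ.lookup-result found)
  ... | no  none  = inj₂ noProper
    where
    noProper : NoProperSubSync P
    noProper Q sQ Q≤P with isZero? Q | Q ≟P P
    ... | yes Q≐0 | _       = inj₁ Q≐0
    ... | no  _   | yes Q≐P = inj₂ Q≐P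
    ... | no  Q≠0 | no  Q≉P =
      ⊥-elim (none (Any.map (λ Q≐Q′ → proper-resp Q≐Q′ (sQ , Q≠0 , Q≉P , Q≤P)) (below-complete Q≤P)))

  minimal? : ∀ P → Dec (IsMinimalSync f g P)
  minimal? P with sync? P ×-dec ¬? (isZero? P) | findProperSubSync P
  ... | no  notSyncNonzero | _              = no (λ (sP , P≠0 , _) → notSyncNonzero (sP , P≠0))
  ... | yes (sP , P≠0)     | inj₂ noProper  = yes (sP , P≠0 , noProper)
  ... | yes _ | inj₁ (Q , sQ , Q≠0 , Q≉P , Q≤P) =
    no (λ (_ , _ , noProper) → Sum.[ Q≠0 , Q≉P ]′ (noProper Q sQ Q≤P))

  minimal-resp : ∀ {P P′} → P ≐P P′ → IsMinimalSync f g P → IsMinimalSync f g P′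
  minimal-resp P≐P′ (sP , P≠0 , noProper) =
    sync-resp P≐P′ sP , (λ P′≐0 → P≠0 (≐P-trans P≐P′ P′≐0)) ,
    λ Q sQ Q≤P′ → Sum.map₂ (λ Q≐P → ≐P-trans Q≐P P≐P′) (noProper Q sQ (≤P-trans Q≤P′ (≐P⇒≤P (≐P-sym P≐P′))))

  minimalBelow : ∀ P → IsSync f g P → ¬ IsZeroP P → ∃ λ Q → IsMinimalSync f g Q × Q ≤P P
  minimalBelow P = descend P (⊏-wellFounded P)
    where
    descend : ∀ P → Acc _⊏_ P → IsSync f g P → ¬ IsZeroP P → ∃ λ Q → IsMinimalSync f g Q × Q ≤P P
    descend P (acc smaller) sP P≠0 with findProperSubSync P
    ... | inj₂ noProper = P , (sP , P≠0 , noProper) , ≤P-refl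
    ... | inj₁ (Q , sQ , Q≠0 , Q≉P , Q≤P) with descend Q (smaller (⊏-strict Q≤P Q≉P)) sQ Q≠0
    ...   | R , mR , R≤Q = R , mR , ≤P-trans R≤Q Q≤P

  BoundedBy : ℕ → Set
  BoundedBy N = ∀ P → IsMinimalSync f g P → P ≤P uniform N

  enumerate : ∀ {N} → BoundedBy N → Σ ℕ λ s → Σ (Fin s → Pair a b) (IsEnumMinSync f g s)
  enumerate {N} bounded = length L , lookup L , minimal , lookup-injective (deduplicate-! (pairDecSetoid a b) candidates) , complete
    where
    candidates : List (Pair a b)
    candidates = filter minimal? (below (uniform N))
    L : List (Pair a b)
    L = deduplicate _≟P_ candidates
    minimal : ∀ i → IsMinimalSync f g (lookup L i)
    minimal i = All.lookup (Allₚ.deduplicate⁺ _≟P_ (Allₚ.all-filter minimal? (below (uniform N)))) (∈-lookup i)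
    complete : ∀ P → IsMinimalSync f g P → Σ (Fin (length L)) (λ i → lookup L i ≐P P)
    complete P mP = Any.index P∈L , ≐P-sym (Anyₚ.lookup-index P∈L)
      where
      P∈L : Any (P ≐P_) L
      P∈L = SetoidMembership.∈-deduplicate⁺ pairSetoid _≟P_ (λ Q≐P R≐P → ≐P-trans R≐P (≐P-sym Q≐P))
              (SetoidMembership.∈-filter⁺ pairSetoid minimal? minimal-resp (below-complete (bounded P mP)) mP)

  module _ {s} {e : Fin s → Pair a b} (en : IsEnumMinSync f g s e) where

    decompose : ∀ P → IsSync f g P → Σ (M s) λ c → comb e c ≐P P
    decompose P = peel P (⊏-wellFounded P)
      where
      peel : ∀ P → Acc _⊏_ P → IsSync f g P → Σ (M s) λ c → comb e c ≐P P
      peel P (acc smaller) sP with isZero? P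
      ... | yes P≐0 = zeroM , ≐P-trans (comb-zero e) (≐P-sym P≐0)
      ... | no  P≠0 with minimalBelow P sP P≠0
      ... | Q , mQ@(sQ , Q≠0 , _) , Q≤P with proj₂ (proj₂ en) Q mQ
      ... | i , eᵢ≐Q with peel (P ∸P Q) (smaller (remainder⊏ Q≤P Q≠0)) (sync-∸ Q≤P sQ sP)
      ... | c , c≐ = c +M idArr s i , comb-addUnit e c i Q≤P eᵢ≐Q c≐

    weakPullback : IsWeakPullbackSquare f g (projP e) (projQ e)
    weakPullback = (λ i → proj₁ (proj₁ en i)) , mediate
      where
      mediate : ∀ y (α : Arr y a) (β : Arr y b) → (f ∘M α) ≈Arr (g ∘M β) →
        Σ (Arr y s) (λ h → ((projP e ∘M h) ≈Arr α) × ((projQ e ∘M h) ≈Arr β))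
      mediate y α β commutes = (proj₁ ∘ split) , (proj₁ ∘ proj₂ ∘ split) , (proj₂ ∘ proj₂ ∘ split)
        where
        split : ∀ k → Σ (M s) λ c → comb e c ≐P (α k , β k)
        split k = decompose (α k , β k) (commutes k)

Close : ℕ → ℕ → ℕ → Set
Close K u v = u ≤ v + K × v ≤ u + K

close? : ∀ K u v → Dec (Close K u v)
close? K u v = (u ≤? v + K) ×-dec (v ≤? u + K)

close-sym : ∀ {K u v} → Close K u v → Close K v u
close-sym (u≤ , v≤) = v≤ , u≤

close-step : ∀ {K u v α β} → u ≤ v → Close K u v → β ≤ α → α ≤ K → Close K (u + α) (v + β)
close-step {K} {u} {v} {α} {β} u≤v (_ , v≤u+K) β≤α α≤K =
  ≤-trans (+-mono-≤ u≤v α≤K) (+-monoˡ-≤ K (m≤m+n v β)) ,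
  ≤-trans (+-mono-≤ v≤u+K β≤α) (≤-reflexive (swap-last u K α))
  where
  swap-last : ∀ p q r → p + q + r ≡ p + r + q
  swap-last = solve-∀

offset-increment : ∀ {K u₁ v₁ u₂ v₂ X Y} → v₁ ≤ u₁ + K → v₂ ≤ u₂ + K →
  u₁ + K ∸ v₁ ≡ u₂ + K ∸ v₂ → X + u₁ ≡ u₂ → Y + v₁ ≡ v₂ → X ≡ Y
offset-increment {K} {u₁} {v₁} {u₂} {v₂} {X} {Y} v₁≤ v₂≤ same incX incY = +-cancelʳ-≡ (w + v₁) X Y (begin
  X + (w + v₁)     ≡⟨ cong (X +_) (m∸n+n≡m v₁≤) ⟩
  X + (u₁ + K)     ≡⟨ +-assoc X u₁ K ⟨
  X + u₁ + K       ≡⟨ cong (_+ K) incX ⟩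
  u₂ + K           ≡⟨ m∸n+n≡m v₂≤ ⟨
  u₂ + K ∸ v₂ + v₂ ≡⟨ cong₂ _+_ (sym same) (sym incY) ⟩
  w + (Y + v₁)     ≡⟨ exchange w Y v₁ ⟩
  Y + (w + v₁)     ∎)
  where
  w : ℕ
  w = u₁ + K ∸ v₁
  exchange : ∀ p q r → p + (q + r) ≡ q + (p + r)
  exchange = solve-∀

remainder-leans : ∀ {n} {c ch : M n} (W₁ W₂ : Fin n → ℕ) → ch ≤M c → dot c W₁ ≡ dot c W₂ →
  dot ch W₁ ≤ dot ch W₂ → dot (c ∸M ch) W₂ ≤ dot (c ∸M ch) W₁
remainder-leans {c = c} {ch} W₁ W₂ ch≤c balanced leans = +-cancelʳ-≤ (dot ch W₁) _ _
  (≤-trans (+-monoʳ-≤ (dot (c ∸M ch) W₂) leans)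
           (≤-reflexive (trans (dot-∸ W₂ ch≤c) (trans (sym balanced) (sym (dot-∸ W₁ ch≤c))))))

-- Steinitz-type exchange lemma.  Adding the elements of c one at a time,
-- always choosing one that pushes the lagging weight forward, produces a chain
-- 0 = ch₀ ≤ ch₁ ≤ … with |dot chₖ A − dot chₖ B| ≤ K.  Among 2K+2 of its elements
-- two have equal offset, and their difference is a balanced sub-multiset.
module Balancing {n} (A B : Fin n → ℕ) (K : ℕ) (A≤K : ∀ h → A h ≤ K) (B≤K : ∀ h → B h ≤ K)
                 (c : M n) (balanced : dot c A ≡ dot c B) where

  Gap : M n → Set
  Gap ch = Close K (dot ch A) (dot ch B)

  gap-zero : Gap zeroM
  gap-zero = subst₂ (Close K) (sym (sumFin-zeros n)) (sym (sumFin-zeros n)) (z≤n , z≤n)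

  gap-addUnit : ∀ ch h → Close K (dot ch A + A h) (dot ch B + B h) → Gap (ch +M idArr n h)
  gap-addUnit ch h = subst₂ (Close K) (sym (addUnit A)) (sym (addUnit B))
    where
    addUnit : ∀ W → dot (ch +M idArr n h) W ≡ dot ch W + W h
    addUnit W = trans (dot-+ ch (idArr n h) W) (cong (dot ch W +_) (dot-idArr n h W))

  Addable : M n → Fin n → Set
  Addable ch h = 1 ≤ c h ∸ ch h × Gap (ch +M idArr n h)

  addable? : ∀ ch h → Dec (Addable ch h)
  addable? ch h = (1 ≤? c h ∸ ch h) ×-dec close? K _ _

  -- Before c is exhausted some element is addable: take one whose weight favours the lagging side.
  addable-exists : ∀ ch → ch ≤M c → tot ch < tot c → Gap ch → ∃ (Addable ch)
  addable-exists ch ch≤c ch<c gap = towardsLagging (dot ch A ≤? dot ch B)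
    where
    nonempty : 1 ≤ tot (c ∸M ch)
    nonempty = ∸M-nonempty ch≤c ch<c
    towardsLagging : Dec (dot ch A ≤ dot ch B) → ∃ (Addable ch)
    towardsLagging (yes A≤B) =
      let h , 1≤ , Bh≤Ah = pick A B (c ∸M ch) nonempty (remainder-leans A B ch≤c balanced A≤B)
      in  h , 1≤ , gap-addUnit ch h (close-step A≤B gap Bh≤Ah (A≤K h))
    towardsLagging (no A≰B) =
      let B≤A = <⇒≤ (≰⇒> A≰B)
          h , 1≤ , Ah≤Bh = pick B A (c ∸M ch) nonempty (remainder-leans B A ch≤c (sym balanced) B≤A)
      in  h , 1≤ , gap-addUnit ch h (close-sym (close-step B≤A (close-sym gap) Ah≤Bh (B≤K h)))

  step : M n → M n
  step ch with any? (addable? ch)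
  ... | yes (h , _) = ch +M idArr n h
  ... | no  _       = ch

  step-grows : ∀ ch → ch ≤M step ch
  step-grows ch i with any? (addable? ch)
  ... | yes (h , _) = m≤m+n (ch i) _
  ... | no  _       = ≤-refl

  Invariant : ℕ → M n → Set
  Invariant k ch = ch ≤M c × Gap ch × tot ch ≡ k

  step-invariant : ∀ {k ch} → k < tot c → Invariant k ch → Invariant (suc k) (step ch)
  step-invariant {k} {ch} k<c (ch≤c , gap , totk) with any? (addable? ch)
  ... | yes (h , 1≤ , gap′) = addUnit≤ ch≤c 1≤ , gap′ ,
          trans (sumFin-+ n ch (idArr n h)) (trans (cong₂ _+_ totk (tot-idArr n h)) (+-comm k 1))
  ... | no none = ⊥-elim (none (addable-exists ch ch≤c (subst (_< tot c) (sym totk) k<c) gap))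

  chain : ℕ → M n
  chain zero    = zeroM
  chain (suc k) = step (chain k)

  chain-invariant : ∀ k → k ≤ tot c → Invariant k (chain k)
  chain-invariant zero    _   = (λ _ → z≤n) , gap-zero , sumFin-zeros n
  chain-invariant (suc k) k<c = step-invariant k<c (chain-invariant k (<⇒≤ k<c))

  chain-mono : ∀ {i j} → i ≤′ j → chain i ≤M chain j
  chain-mono ≤′-refl          h = ≤-refl
  chain-mono (≤′-step i≤′j) h = ≤-trans (chain-mono i≤′j h) (step-grows _ h)

  offset : ℕ → ℕ
  offset k = dot (chain k) A + K ∸ dot (chain k) B

  offset-bounded : ∀ k → k ≤ tot c → offset k < suc (K + K)
  offset-bounded k k≤c = s≤s (m≤n+o⇒m∸n≤o (dot (chain k) A + K) (dot (chain k) B)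
    (≤-trans (+-monoˡ-≤ K A≤B+K) (≤-reflexive (+-assoc _ K K))))
    where
    A≤B+K : dot (chain k) A ≤ dot (chain k) B + K
    A≤B+K = proj₁ (proj₁ (proj₂ (chain-invariant k k≤c)))

  module Difference {I J} (I≤J : I ≤ J) (J≤c : J ≤ tot c) where
    d : M n
    d = chain J ∸M chain I

    invI : Invariant I (chain I)
    invI = chain-invariant I (≤-trans I≤J J≤c)
    invJ : Invariant J (chain J)
    invJ = chain-invariant J J≤c
    mono : chain I ≤M chain J
    mono = chain-mono (≤⇒≤′ I≤J)

    d≤c : d ≤M c
    d≤c h = ≤-trans (m∸n≤m (chain J h) (chain I h)) (proj₁ invJ h)

    tot-d : tot d + I ≡ J
    tot-d = trans (cong (tot d +_) (sym (proj₂ (proj₂ invI)))) (trans (tot-∸ mono) (proj₂ (proj₂ invJ)))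

    d-balanced : offset I ≡ offset J → dot d A ≡ dot d B
    d-balanced same = offset-increment (proj₂ (proj₁ (proj₂ invI))) (proj₂ (proj₁ (proj₂ invJ))) same (dot-∸ A mono) (dot-∸ B mono)

  offsetFin : suc (suc (K + K)) ≤ tot c → Fin (suc (suc (K + K))) → Fin (suc (K + K))
  offsetFin large t = fromℕ< (offset-bounded (toℕ t) (<⇒≤ (≤-trans (toℕ<n t) large)))

  balancedSubmultiset : suc (suc (K + K)) ≤ tot c → ∃ λ d → d ≤M c × 1 ≤ tot d × tot d < tot c × dot d A ≡ dot d B
  balancedSubmultiset large with pigeonhole ≤-refl (offsetFin large)
  ... | i , j , i<j , same = d , d≤c , 1≤totd , totd<c , d-balanced sameOffset
    where
    open Difference (<⇒≤ i<j) (<⇒≤ (≤-trans (toℕ<n j) large))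
    1≤totd : 1 ≤ tot d
    1≤totd = +-cancelʳ-≤ (toℕ i) 1 (tot d) (subst (suc (toℕ i) ≤_) (sym tot-d) i<j)
    totd<c : tot d < tot c
    totd<c = ≤-<-trans (≤-trans (m≤m+n (tot d) (toℕ i)) (≤-reflexive tot-d)) (≤-trans (toℕ<n j) large)
    sameOffset : offset (toℕ i) ≡ offset (toℕ j)
    sameOffset = trans (sym (toℕ-fromℕ< _)) (trans (cong toℕ same) (toℕ-fromℕ< _))

restrict : ∀ {a x} → Arr a (suc x) → Arr a x
restrict f i = tail (f i)

singletonEntry : ∀ {n} (U : M n) i → (idArr n i ≤M U → idArr n i ≐ zeroM ⊎ idArr n i ≐ U) → U i ≤ 1
singletonEntry {n} U i dichotomy with U i ≤? 1
... | yes Ui≤1 = Ui≤1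
... | no  Ui≰1 with dichotomy (idArr≤ (<⇒≤ (≰⇒> Ui≰1)))
...   | inj₁ unit≐0 = ⊥-elim (1+n≢0 (trans (sym (idArr-diag n i)) (unit≐0 i)))
...   | inj₂ unit≐U = ⊥-elim (Ui≰1 (≤-reflexive (trans (sym (unit≐U i)) (idArr-diag n i))))

-- Empty target: every pair synchronises, so minimal synchronisations are
-- singletons and their entries are at most 1.
boundedEmptyTarget : ∀ {a b} (f : Arr a 0) (g : Arr b 0) → Synchronisations.BoundedBy f g 1
boundedEmptyTarget {a} {b} f g (U , V) (_ , _ , noProper) =
  (λ i → singletonEntry U i (λ unit≤U → Sum.map proj₁ proj₁ (noProper (idArr a i , zeroM) (λ ()) (unit≤U , λ _ → z≤n)))) ,
  (λ j → singletonEntry V j (λ unit≤V → Sum.map proj₂ proj₂ (noProper (zeroM , idArr b j) (λ ()) ((λ _ → z≤n) , unit≤V))))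

module ExtendTarget {a b x} (f : Arr a (suc x)) (g : Arr b (suc x)) {N : ℕ}
                    (boundedRestriction : Synchronisations.BoundedBy (restrict f) (restrict g) N) where

  module Full = Synchronisations f g
  module Restricted = Synchronisations (restrict f) (restrict g)

  s : ℕ
  s = proj₁ (Restricted.enumerate boundedRestriction)
  e : Fin s → Pair a b
  e = proj₁ (proj₂ (Restricted.enumerate boundedRestriction))
  en : IsEnumMinSync (restrict f) (restrict g) s e
  en = proj₂ (proj₂ (Restricted.enumerate boundedRestriction))

  A B : Fin s → ℕ
  A h = ext f (projP e h) zero
  B h = ext g (projQ e h) zero

  K : ℕ
  K = sumFin s (λ h → A h + B h)

  A≤K : ∀ h → A h ≤ K
  A≤K h = ≤-trans (m≤m+n (A h) (B h)) (term≤sumFin s (λ h → A h + B h) h)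

  B≤K : ∀ h → B h ≤ K
  B≤K h = ≤-trans (m≤n+m (B h) (A h)) (term≤sumFin s (λ h → A h + B h) h)

  -- A combination synchronises at the new point iff its coefficients balance A and B;
  -- at the other points it synchronises because every member does.
  comb-sync : ∀ c → dot c A ≡ dot c B → IsSync f g (comb e c)
  comb-sync c balanced zero = begin
    ext f (ext (projP e) c) zero ≡⟨ ext-ext f (projP e) c zero ⟩
    dot c A                      ≡⟨ balanced ⟩
    dot c B                      ≡⟨ ext-ext g (projQ e) c zero ⟨
    ext g (ext (projQ e) c) zero ∎
  comb-sync c balanced (suc z) = begin
    ext f (ext (projP e) c) (suc z)  ≡⟨ ext-ext f (projP e) c (suc z) ⟩
    ext (f ∘M projP e) c (suc z)     ≡⟨ sumFin-cong s (λ h → cong (c h *_) (proj₁ (proj₁ en h) z)) ⟩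
    ext (g ∘M projQ e) c (suc z)     ≡⟨ ext-ext g (projQ e) c (suc z) ⟨
    ext g (ext (projQ e) c) (suc z)  ∎

  sync-balanced : ∀ {c P} → comb e c ≐P P → IsSync f g P → dot c A ≡ dot c B
  sync-balanced {c} {U , V} (U≐ , V≐) sP = begin
    dot c A                      ≡⟨ ext-ext f (projP e) c zero ⟨
    ext f (ext (projP e) c) zero ≡⟨ ext-cong f U≐ zero ⟩
    ext f U zero                 ≡⟨ sP zero ⟩
    ext g V zero                 ≡⟨ ext-cong g V≐ zero ⟨
    ext g (ext (projQ e) c) zero ≡⟨ ext-ext g (projQ e) c zero ⟩
    dot c B                      ∎

  -- A non-empty combination is non-zero, since it lies above a (non-zero) member.
  comb-nonzero : ∀ d → 1 ≤ tot d → ¬ IsZeroP (comb e d)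
  comb-nonzero d 1≤d d≐0 = proj₁ (proj₂ (proj₁ en h)) (≤P-zero (comb-member e {d} 1≤dh) d≐0)
    where
    h : Fin s
    h = proj₁ (positiveEntry d 1≤d)
    1≤dh : 1 ≤ d h
    1≤dh = proj₂ (positiveEntry d 1≤d)

  -- A balanced proper part d of the coefficients of a minimal P would give a
  -- synchronisation strictly between 0 and P.
  noBalancedPart : ∀ {P c d} → IsMinimalSync f g P → comb e c ≐P P →
    d ≤M c → 1 ≤ tot d → tot d < tot c → dot d A ≡ dot d B → ⊥
  noBalancedPart {P} {c} {d} (_ , _ , noProper) c≐P d≤c 1≤d d<c d-balanced
    with noProper (comb e d) (comb-sync d d-balanced) (≤P-trans (comb-mono e d≤c) (≐P⇒≤P c≐P))
  ... | inj₁ d≐0 = comb-nonzero d 1≤d d≐0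
  ... | inj₂ d≐P = comb-nonzero (c ∸M d) (∸M-nonempty d≤c d<c) (comb-cancel e d≤c (≐P-trans d≐P (≐P-sym c≐P)))

  smallCoefficients : ∀ {P c} → IsMinimalSync f g P → comb e c ≐P P → tot c ≤ suc (K + K)
  smallCoefficients {P} {c} mP c≐P with tot c ≤? suc (K + K)
  ... | yes small = small
  ... | no  large =
    let d , d≤c , 1≤d , d<c , d-balanced =
          Balancing.balancedSubmultiset A B K A≤K B≤K c (sync-balanced {c} c≐P (proj₁ mP)) (≰⇒> large)
    in  ⊥-elim (noBalancedPart mP c≐P d≤c 1≤d d<c d-balanced)

  -- Entries of a minimal P = comb e c are at most |c| N ≤ (2K+1) N.
  boundedExtension : Full.BoundedBy (suc (K + K) * N)
  boundedExtension P mP = entries (projP e) (proj₁ ∘ memberBound) (proj₁ c≐P) ,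
                          entries (projQ e) (proj₂ ∘ memberBound) (proj₂ c≐P)
    where
    decomposition : Σ (M s) λ c → comb e c ≐P P
    decomposition = Restricted.decompose en P (λ z → proj₁ mP (suc z))
    c : M s
    c = proj₁ decomposition
    c≐P : comb e c ≐P P
    c≐P = proj₂ decomposition
    memberBound : ∀ h → e h ≤P uniform N
    memberBound h = boundedRestriction (e h) (proj₁ en h)
    entries : ∀ {n} (k : Arr s n) → (∀ h z → k h z ≤ N) → ∀ {W} → ext k c ≐ W → ∀ z → W z ≤ suc (K + K) * N
    entries k k≤N c≐W z = subst (_≤ _) (c≐W z) (≤-trans (ext-bounded k N k≤N c z) (*-monoˡ-≤ N (smallCoefficients mP c≐P)))

boundedMinimal : ∀ x {a b} (f : Arr a x) (g : Arr b x) → Σ ℕ (Synchronisations.BoundedBy f g)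
boundedMinimal zero    f g = 1 , boundedEmptyTarget f g
boundedMinimal (suc x) f g = _ , ExtendTarget.boundedExtension f g (proj₂ (boundedMinimal x (restrict f) (restrict g)))

mainTheorem8 : (a b x : ℕ) (f : Arr a x) (g : Arr b x) →
    (Σ ℕ (λ s → Σ (Fin s → M a × M b) (λ e → IsEnumMinSync f g s e)))
    × ((s : ℕ) (e : Fin s → M a × M b) → IsEnumMinSync f g s e →
    IsWeakPullbackSquare f g (projP e) (projQ e))
mainTheorem8 a b x f g = enumerate (proj₂ (boundedMinimal x f g)) , λ s e → weakPullback
  where open Synchronisations f g
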